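{- Let $\ell\ge4$ be an integer. Then $\theta$ restricts to an order preserving bijection from $\mathcal{V}_\ell$ to $\mathcal{V}_{\ell+1}$.
   Context: Words: $E=\{a,b\}$, $E^*$ the monoid of finite words under concatenation, $\epsilon$ the empty word, $|w|$ the length; $u\le w$ means $u$ is a prefix of $w$ (this is the order), $u<w$ means $u\le w$, $u\ne w$. $\theta:E^*\to E^*$ is the monoid morphism with $\theta(a)=ab$, $\theta(b)=a$. $w_1=a$, $w_2=ab$, $w_{i+2}=w_{i+1}w_i$, $w_\infty=\lim w_i$; prefixes of $w_\infty$ are words $\le w_i$ for some $i$. Fibonacci numbers $F_{ -1}=0,F_0=1,F_{i+2}=F_{i+1}+F_i$. $\mathcal{F}=\{\epsilon,w_1,w_2,\dots\}$. For a prefix $v$ of $w_\infty$: $\iota(v)=v$ if $v\in\mathcal{F}$, else $w_i<v<w_{i+1}$ for some $i\ge3$ and $\iota(v)$ is the prefix of $w_\infty$ of length $|v|-2F_{i-2}$; $\alpha(v)=\lim_k\iota^k(v)$. For $\ell\ge1$, $\mathcal{V}_\ell=\{v\text{ prefix of }w_\infty: \alpha(v)\ge w_\ell\}$. -}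

module Defs where

open import Data.Nat using (ℕ; zero; suc; _+_; _*_; _∸_; _≤_; _<_; _<ᵇ_)
open import Data.Bool using (Bool; true; false; if_then_else_; _∨_)
open import Data.List using (List; []; _∷_; _++_; length; take; concatMap)
open import Data.Product using (Σ; ∃; _×_; _,_)
open import Relation.Binary.PropositionalEquality using (_≡_; _≢_)
open import Relation.Nullary.Decidable using (⌊_⌋)
open import Function using (_∘_)

data E : Set where
  a b : E

_≟E_ : (x y : E) → Bool
a ≟E a = true
b ≟E b = true
_ ≟E _ = false

Word : Set
Word = List E

_==_ : Word → Word → Bool
[] == [] = true
(x ∷ u) == (y ∷ v) = if x ≟E y then u == v else false
_ == _ = false

_⊑_ : Word → Word → Set
u ⊑ w = ∃ λ z → u ++ z ≡ w

_⊏_ : Word → Word → Set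
u ⊏ w = u ⊑ w × u ≢ w

θ₀ : E → Word
θ₀ a = a ∷ b ∷ []
θ₀ b = a ∷ []

θ : Word → Word
θ = concatMap θ₀

-- Fibonacci words; wF (suc i) = w_{i+1} of the paper (w_1 = a, w_2 = ab,
-- w_{i+2} = w_{i+1} w_i); wF 0 = ε (auxiliary, not one of the paper's w_i)
wF : ℕ → Word
wF zero = []
wF (suc zero) = a ∷ []
wF (suc (suc zero)) = a ∷ b ∷ []
wF (suc (suc (suc n))) = wF (suc (suc n)) ++ wF (suc n)

w : ℕ → Word
w = wF

-- Fibonacci numbers F_0 = 1, F_1 = 1, F_{i+2} = F_{i+1} + F_i (so |w_i| = F_i)
F : ℕ → ℕ
F zero = 1
F (suc zero) = 1
F (suc (suc n)) = F (suc n) + F n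

PrefixW∞ : Word → Set
PrefixW∞ v = ∃ λ i → v ⊑ w i

-- the prefix of w_∞ of length n (w_{n+1} has length F_{n+1} ≥ n+1)
pref : ℕ → Word
pref n = take n (w (suc n))

-- decide membership in 𝓕 = {ε, w_1, w_2, ...}: check v == wF i for i ≤ |v| + 1
-- (|w_i| = F_i ≥ i, so no larger index can match)
inFUpTo : ℕ → Word → Bool
inFUpTo zero v = v == wF zero
inFUpTo (suc i) v = (v == wF (suc i)) ∨ inFUpTo i v

inF : Word → Bool
inF v = inFUpTo (suc (length v)) v

idxUpTo : ℕ → ℕ → ℕ
idxUpTo zero n = zero
idxUpTo (suc k) n = if F (suc k) <ᵇ n then suc k else idxUpTo k n

-- for a prefix v ∉ 𝓕, the unique i ≥ 3 with w_i < v < w_{i+1}, i.e. F_i < |v| < F_{i+1}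
idx : Word → ℕ
idx v = idxUpTo (length v) (length v)

ι : Word → Word
ι v = if inF v then v else pref (length v ∸ 2 * F (idx v ∸ 2))

iter : ℕ → Word → Word
iter zero v = v
iter (suc k) v = ι (iter k v)

-- α(v) = lim_k ι^k(v): the (discrete) limit, i.e. the eventual value of ι^k(v)
IsAlpha : Word → Word → Set
IsAlpha v u = ∃ λ K → ∀ k → K ≤ k → iter k v ≡ u

V : ℕ → Word → Set
V ℓ v = PrefixW∞ v × (∃ λ u → IsAlpha v u × w ℓ ⊑ u)

{-# OPTIONS --safe #-}
module Submission where

-- A prefix of w∞ is determined by its length, so θ, ι and α can be computed on lengths
-- (θℕ, ιℕ, and n ⇓ r for α (pref n) = pref r).
-- Since w_{k+1} w_{k+2} and w_{k+3} = w_{k+2} w_{k+1} share a prefix of length F_{k+3} − 2,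
-- pref (F_{k+1} + x) = w_{k+1} · pref x for x + 2 ≤ F_{k+2}; applying θ gives
-- θℕ (F_{k+1} + x) = F_{k+2} + θℕ x.  A length strictly between F_{j+4} and F_{j+5} is
-- F_{j+4} + m, which ι sends to F_{j+1} + m; θ sends these two lengths to F_{j+5} + θℕ m
-- and F_{j+2} + θℕ m, so θ commutes with ι, except when F_{j+1} + m = F_{j+3} − 1, a length
-- whose α is at most w_3.  Hence when α v ≥ w_4, θ carries the ι-orbit of v to that of θ v
-- and α (θ v) = θ (α v), so θ maps 𝓥_ℓ into 𝓥_{ℓ+1}; running the same computation backwards
-- along the orbit of x ∈ 𝓥_{ℓ+1} produces a preimage.  Injectivity and monotonicity hold for θ
-- on all words.

open import Defs
open import Data.Bool using (true; false; T; if_then_else_; _∨_)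
open import Data.Bool.Properties using (∨-zeroʳ)
open import Data.List using ([]; _∷_; _++_; length; drop)
open import Data.List.Properties
  using ( ∷-injective; ∷-injectiveʳ; ++-cancelˡ; ++-assoc; ++-identityʳ
        ; length-++; length-take; take++drop≡id; concatMap-++)
open import Data.Nat
  using ( ℕ; zero; suc; _≤_; _<_; _+_; _*_; _∸_; _⊔_; _⊓_; _<ᵇ_
        ; z≤n; s≤s; z<s; _≤′_; ≤′-refl; ≤′-step)
open import Data.Nat.Induction using (<-rec)
open import Data.Nat.Properties
open import Data.Nat.Tactic.RingSolver using (solve-∀)
open import Data.Product using (∃; ∃₂; _×_; _,_; proj₁; proj₂)
open import Data.Sum using (_⊎_; inj₁; inj₂)
open import Function using (_∘_)
open import Relation.Binary.Definitions using (Reflexive; Transitive)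
open import Relation.Binary.PropositionalEquality
  using (_≡_; _≢_; refl; sym; trans; cong; cong₂; subst; subst₂; module ≡-Reasoning)
open import Relation.Nullary using (yes; no; contradiction)

chain-mono : ∀ {A : Set} (_∼_ : A → A → Set) → Reflexive _∼_ → Transitive _∼_ →
             (f : ℕ → A) → (∀ n → f n ∼ f (suc n)) → ∀ {m n} → m ≤ n → f m ∼ f n
chain-mono _∼_ ∼-refl ∼-trans f step {m} m≤n = go (≤⇒≤′ m≤n)
  where
  go : ∀ {n} → m ≤′ n → f m ∼ f n
  go ≤′-refl        = ∼-refl
  go (≤′-step m≤′n) = ∼-trans (go m≤′n) (step _)

⊑-refl : Reflexive _⊑_
⊑-refl {u} = [] , ++-identityʳ u

⊑-trans : Transitive _⊑_
⊑-trans {u} (z , refl) (z′ , refl) = z ++ z′ , sym (++-assoc u z z′)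

++-monoʳ-⊑ : ∀ p {u v} → u ⊑ v → (p ++ u) ⊑ (p ++ v)
++-monoʳ-⊑ p {u} (z , refl) = z , ++-assoc p u z

length-mono-⊑ : ∀ {u v} → u ⊑ v → length u ≤ length v
length-mono-⊑ {u} (z , refl) = subst (length u ≤_) (sym (length-++ u)) (m≤m+n _ _)

⊑∧length≡⇒≡ : ∀ {u v} → u ⊑ v → length u ≡ length v → u ≡ v
⊑∧length≡⇒≡ {[]}    {[]}    _          _  = refl
⊑∧length≡⇒≡ {c ∷ u} {_ ∷ _} (z , refl) eq =
  cong (c ∷_) (⊑∧length≡⇒≡ (z , refl) (suc-injective eq))

⊑-by-length : ∀ {u v x} → u ⊑ x → v ⊑ x → length u ≤ length v → u ⊑ v
⊑-by-length {[]}            _          _         _             = _ , refl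
⊑-by-length {c ∷ u} {d ∷ v} (z , refl) (z′ , eq) (s≤s |u|≤|v|) with ∷-injective eq
... | refl , eq′ = ++-monoʳ-⊑ (c ∷ []) (⊑-by-length (z , refl) (z′ , eq′) |u|≤|v|)

-- Fibonacci numbers and words

F-pos : ∀ n → 0 < F n
F-pos zero          = s≤s z≤n
F-pos (suc zero)    = s≤s z≤n
F-pos (suc (suc n)) = ≤-trans (F-pos (suc n)) (m≤m+n _ _)

F≤F-suc : ∀ n → F n ≤ F (suc n)
F≤F-suc zero    = ≤-refl
F≤F-suc (suc n) = m≤m+n _ _

F-mono : ∀ {m n} → m ≤ n → F m ≤ F n
F-mono = chain-mono _≤_ ≤-refl ≤-trans F F≤F-suc

n≤F : ∀ n → n ≤ F n
n≤F zero          = z≤n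
n≤F (suc zero)    = s≤s z≤n
n≤F (suc (suc n)) = subst (_≤ F (suc n) + F n) (+-comm (suc n) 1) (+-mono-≤ (n≤F (suc n)) (F-pos n))

2≤F : ∀ j → 2 ≤ F (2 + j)
2≤F j = ≤-trans (m≤m+n 2 j) (n≤F (2 + j))

F-gap : ∀ {n} i k → F i < n → n < F (suc i) → n ≢ F k
F-gap i k Fᵢ<n n<Fᵢ₊₁ refl with k ≤? i
... | yes k≤i = <⇒≱ Fᵢ<n (F-mono k≤i)
... | no  k≰i = <⇒≱ n<Fᵢ₊₁ (F-mono (≰⇒> k≰i))

F₄+m≡F₁+m+2F₂ : ∀ j m → F (4 + j) + m ≡ F (1 + j) + m + 2 * F (2 + j)
F₄+m≡F₁+m+2F₂ j = lemma (F j) (F (1 + j))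
  where
  lemma : ∀ x y m → (y + x) + y + (y + x) + m ≡ y + m + 2 * (y + x)
  lemma = solve-∀

wF⊑wF-suc : ∀ i → wF i ⊑ wF (suc i)
wF⊑wF-suc zero          = _ , refl
wF⊑wF-suc (suc zero)    = _ , refl
wF⊑wF-suc (suc (suc i)) = wF (suc i) , refl

wF-mono : ∀ {i j} → i ≤ j → wF i ⊑ wF j
wF-mono = chain-mono _⊑_ ⊑-refl ⊑-trans wF wF⊑wF-suc

length-wF : ∀ i → length (wF (suc i)) ≡ F (suc i)
length-wF zero          = refl
length-wF (suc zero)    = refl
length-wF (suc (suc i)) =
  trans (length-++ (wF (suc (suc i)))) (cong₂ _+_ (length-wF (suc i)) (length-wF i))

-- Prefixes of w∞ and the morphism θ

PrefixW∞-⊑ : ∀ {u v} → PrefixW∞ u → PrefixW∞ v → length u ≤ length v → u ⊑ v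
PrefixW∞-⊑ (i , u⊑wᵢ) (j , v⊑wⱼ) =
  ⊑-by-length (⊑-trans u⊑wᵢ (wF-mono (m≤m⊔n i j))) (⊑-trans v⊑wⱼ (wF-mono (m≤n⊔m i j)))

PrefixW∞-≡ : ∀ {u v} → PrefixW∞ u → PrefixW∞ v → length u ≡ length v → u ≡ v
PrefixW∞-≡ pu pv eq = ⊑∧length≡⇒≡ (PrefixW∞-⊑ pu pv (≤-reflexive eq)) eq

PrefixW∞-pref : ∀ n → PrefixW∞ (pref n)
PrefixW∞-pref n = suc n , drop n (wF (suc n)) , take++drop≡id n _

length-pref : ∀ n → length (pref n) ≡ n
length-pref n = trans (length-take n (wF (suc n)))
  (trans (cong (n ⊓_) (length-wF n)) (m≤n⇒m⊓n≡m (≤-trans (n≤1+n n) (n≤F (suc n)))))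

PrefixW∞⇒≡pref : ∀ {u} → PrefixW∞ u → u ≡ pref (length u)
PrefixW∞⇒≡pref pu = PrefixW∞-≡ pu (PrefixW∞-pref _) (sym (length-pref _))

pref-F : ∀ j → pref (F (suc j)) ≡ wF (suc j)
pref-F j = PrefixW∞-≡ (PrefixW∞-pref _) (suc j , ⊑-refl) (trans (length-pref _) (sym (length-wF j)))

pref-mono : ∀ {m n} → m ≤ n → pref m ⊑ pref n
pref-mono {m} {n} m≤n = PrefixW∞-⊑ (PrefixW∞-pref m) (PrefixW∞-pref n)
  (subst₂ _≤_ (sym (length-pref m)) (sym (length-pref n)) m≤n)

θ-++ : ∀ u v → θ (u ++ v) ≡ θ u ++ θ v
θ-++ = concatMap-++ θ₀

θ-wF : ∀ i → θ (wF (suc i)) ≡ wF (suc (suc i))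
θ-wF zero          = refl
θ-wF (suc zero)    = refl
θ-wF (suc (suc i)) = trans (θ-++ (wF (suc (suc i))) (wF (suc i))) (cong₂ _++_ (θ-wF (suc i)) (θ-wF i))

length-θ-wF : ∀ i → length (θ (wF (suc i))) ≡ F (suc (suc i))
length-θ-wF i = trans (cong length (θ-wF i)) (length-wF (suc i))

θ-mono-⊑ : ∀ {u v} → u ⊑ v → θ u ⊑ θ v
θ-mono-⊑ {u} (z , refl) = θ z , sym (θ-++ u z)

θ-PrefixW∞ : ∀ {u} → PrefixW∞ u → PrefixW∞ (θ u)
θ-PrefixW∞     (zero  , u⊑w₀) = zero , θ-mono-⊑ u⊑w₀
θ-PrefixW∞ {u} (suc i , u⊑wᵢ) = suc (suc i) , subst (θ u ⊑_) (θ-wF i) (θ-mono-⊑ u⊑wᵢ)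

θ≢b∷ : ∀ v t → θ v ≢ b ∷ t
θ≢b∷ []      _ ()
θ≢b∷ (a ∷ _) _ ()
θ≢b∷ (b ∷ _) _ ()

θ-injective : ∀ {u v} → θ u ≡ θ v → u ≡ v
θ-injective {[]}    {[]}    _  = refl
θ-injective {[]}    {a ∷ _} ()
θ-injective {[]}    {b ∷ _} ()
θ-injective {a ∷ _} {[]}    ()
θ-injective {b ∷ _} {[]}    ()
θ-injective {a ∷ u} {a ∷ v} eq = cong (a ∷_) (θ-injective (++-cancelˡ (a ∷ b ∷ []) (θ u) (θ v) eq))
θ-injective {b ∷ u} {b ∷ v} eq = cong (b ∷_) (θ-injective (++-cancelˡ (a ∷ []) (θ u) (θ v) eq))
θ-injective {a ∷ u} {b ∷ v} eq = contradiction (sym (∷-injectiveʳ eq)) (θ≢b∷ v _)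
θ-injective {b ∷ u} {a ∷ v} eq = contradiction (∷-injectiveʳ eq) (θ≢b∷ u _)

length≤length-θ : ∀ u → length u ≤ length (θ u)
length≤length-θ []      = z≤n
length≤length-θ (a ∷ u) = s≤s (m≤n⇒m≤1+n (length≤length-θ u))
length≤length-θ (b ∷ u) = s≤s (length≤length-θ u)

-- θ on lengths

θℕ : ℕ → ℕ
θℕ n = length (θ (pref n))

θ-pref : ∀ n → θ (pref n) ≡ pref (θℕ n)
θ-pref n = PrefixW∞⇒≡pref (θ-PrefixW∞ (PrefixW∞-pref n))

θℕ-F : ∀ j → θℕ (F (suc j)) ≡ F (suc (suc j))
θℕ-F j = trans (cong (length ∘ θ) (pref-F j)) (length-θ-wF j)

θℕ-mono-< : ∀ {m n} → m < n → θℕ m < θℕ n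
θℕ-mono-< {m} {n} m<n with pref-mono (<⇒≤ m<n)
... | z , pref-m++z≡pref-n = begin-strict
  θℕ m                          <⟨ m<m+n (θℕ m) (<-≤-trans 0<|z| (length≤length-θ z)) ⟩
  θℕ m + length (θ z)           ≡⟨ sym (length-++ (θ (pref m))) ⟩
  length (θ (pref m) ++ θ z)    ≡⟨ cong length (sym (θ-++ (pref m) z)) ⟩
  length (θ (pref m ++ z))      ≡⟨ cong (length ∘ θ) pref-m++z≡pref-n ⟩
  θℕ n                          ∎
  where
  open ≤-Reasoning
  m+|z|≡n : m + length z ≡ n
  m+|z|≡n = begin-equality
    m + length z                ≡⟨ cong (_+ length z) (sym (length-pref m)) ⟩
    length (pref m) + length z  ≡⟨ sym (length-++ (pref m)) ⟩
    length (pref m ++ z)        ≡⟨ cong length pref-m++z≡pref-n ⟩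
    length (pref n)             ≡⟨ length-pref n ⟩
    n                           ∎
  0<|z| : 0 < length z
  0<|z| = +-cancelˡ-< m 0 (length z) (subst₂ _<_ (sym (+-identityʳ m)) (sym m+|z|≡n) m<n)

θℕ-mono-≤ : ∀ {m n} → m ≤ n → θℕ m ≤ θℕ n
θℕ-mono-≤ m≤n with m≤n⇒m<n∨m≡n m≤n
... | inj₁ m<n  = <⇒≤ (θℕ-mono-< m<n)
... | inj₂ refl = ≤-refl

θℕ-cancel-≤ : ∀ {m n} → θℕ m ≤ θℕ n → m ≤ n
θℕ-cancel-≤ θm≤θn = ≮⇒≥ (λ n<m → <⇒≱ (θℕ-mono-< n<m) θm≤θn)

θℕ-cancel-< : ∀ {m n} → θℕ m < θℕ n → m < n
θℕ-cancel-< θm<θn = ≰⇒> (λ n≤m → <⇒≱ θm<θn (θℕ-mono-≤ n≤m))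

wF-near-comm : ∀ n → ∃ λ z → length z + 2 ≡ F (3 + n)
                             × z ⊑ (wF (1 + n) ++ wF (2 + n)) × z ⊑ wF (3 + n)
wF-near-comm zero    = a ∷ [] , refl , (_ , refl) , (_ , refl)
wF-near-comm (suc n) with wF-near-comm n
... | z , |z|+2≡F₃ , z⊑w₁w₂ , z⊑w₃ =
  wF (2 + n) ++ z , |w₂z|+2≡F₄ , ++-monoʳ-⊑ (wF (2 + n)) z⊑w₃ ,
  subst ((wF (2 + n) ++ z) ⊑_) (sym (++-assoc (wF (2 + n)) (wF (1 + n)) (wF (2 + n))))
        (++-monoʳ-⊑ (wF (2 + n)) z⊑w₁w₂)
  where
  open ≡-Reasoning
  |w₂z|+2≡F₄ : length (wF (2 + n) ++ z) + 2 ≡ F (4 + n)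
  |w₂z|+2≡F₄ = begin
    length (wF (2 + n) ++ z) + 2        ≡⟨ cong (_+ 2) (length-++ (wF (2 + n))) ⟩
    length (wF (2 + n)) + length z + 2  ≡⟨ cong (λ t → t + length z + 2) (length-wF (1 + n)) ⟩
    F (2 + n) + length z + 2            ≡⟨ +-assoc (F (2 + n)) (length z) 2 ⟩
    F (2 + n) + (length z + 2)          ≡⟨ cong (F (2 + n) +_) |z|+2≡F₃ ⟩
    F (2 + n) + F (3 + n)               ≡⟨ +-comm (F (2 + n)) (F (3 + n)) ⟩
    F (4 + n)                           ∎

wF++pref-PrefixW∞ : ∀ j x → x + 2 ≤ F (2 + j) → PrefixW∞ (wF (1 + j) ++ pref x)
wF++pref-PrefixW∞ zero    zero    _           = 1 , ⊑-refl
wF++pref-PrefixW∞ zero    (suc x) (s≤s x+2≤1) = contradiction x+2≤1 (<⇒≱ (m≤n+m 2 x))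
wF++pref-PrefixW∞ (suc n) x       x+2≤F₃ with wF-near-comm n
... | z , |z|+2≡F₃ , z⊑w₁w₂ , z⊑w₃ =
  4 + n , subst ((wF (2 + n) ++ pref x) ⊑_) (sym (++-assoc (wF (2 + n)) (wF (1 + n)) (wF (2 + n))))
                (++-monoʳ-⊑ (wF (2 + n)) (⊑-trans x⊑z z⊑w₁w₂))
  where
  x⊑z : pref x ⊑ z
  x⊑z = PrefixW∞-⊑ (PrefixW∞-pref x) (3 + n , z⊑w₃)
          (subst (_≤ length z) (sym (length-pref x))
                 (+-cancelʳ-≤ 2 x (length z) (subst (x + 2 ≤_) (sym |z|+2≡F₃) x+2≤F₃)))

pref-F+ : ∀ j x → x + 2 ≤ F (2 + j) → pref (F (1 + j) + x) ≡ wF (1 + j) ++ pref x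
pref-F+ j x x+2≤F₂ = sym (PrefixW∞-≡ (wF++pref-PrefixW∞ j x x+2≤F₂) (PrefixW∞-pref _) (begin
  length (wF (1 + j) ++ pref x)         ≡⟨ length-++ (wF (1 + j)) ⟩
  length (wF (1 + j)) + length (pref x) ≡⟨ cong₂ _+_ (length-wF j) (length-pref x) ⟩
  F (1 + j) + x                         ≡⟨ sym (length-pref _) ⟩
  length (pref (F (1 + j) + x))         ∎))
  where open ≡-Reasoning

θℕ-F+ : ∀ j x → x + 2 ≤ F (2 + j) → θℕ (F (1 + j) + x) ≡ F (2 + j) + θℕ x
θℕ-F+ j x x+2≤F₂ = begin
  θℕ (F (1 + j) + x)                     ≡⟨ cong (length ∘ θ) (pref-F+ j x x+2≤F₂) ⟩
  length (θ (wF (1 + j) ++ pref x))      ≡⟨ cong length (θ-++ (wF (1 + j)) (pref x)) ⟩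
  length (θ (wF (1 + j)) ++ θ (pref x))  ≡⟨ length-++ (θ (wF (1 + j))) ⟩
  length (θ (wF (1 + j))) + θℕ x         ≡⟨ cong (_+ θℕ x) (length-θ-wF j) ⟩
  F (2 + j) + θℕ x                       ∎
  where open ≡-Reasoning

θℕ-F+-large : ∀ j x → F (2 + j) ≤ x → x < F (3 + j) → θℕ (F (1 + j) + x) ≡ F (2 + j) + θℕ x
θℕ-F+-large j x F₂≤x x<F₃ with m≤n⇒∃[o]m+o≡n F₂≤x
... | y , refl = begin
  θℕ (F (1 + j) + (F (2 + j) + y))  ≡⟨ cong θℕ (sym (+-assoc (F (1 + j)) (F (2 + j)) y)) ⟩
  θℕ (F (1 + j) + F (2 + j) + y)    ≡⟨ cong (λ t → θℕ (t + y)) (+-comm (F (1 + j)) (F (2 + j))) ⟩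
  θℕ (F (3 + j) + y)                ≡⟨ θℕ-F+ (2 + j) y (≤-trans y+2≤F₃ (F≤F-suc (3 + j))) ⟩
  F (3 + j) + F (2 + j) + θℕ y      ≡⟨ cong (_+ θℕ y) (+-comm (F (3 + j)) (F (2 + j))) ⟩
  F (2 + j) + F (3 + j) + θℕ y      ≡⟨ +-assoc (F (2 + j)) (F (3 + j)) (θℕ y) ⟩
  F (2 + j) + (F (3 + j) + θℕ y)    ≡⟨ cong (F (2 + j) +_) (sym (θℕ-F+ (1 + j) y y+2≤F₃)) ⟩
  F (2 + j) + θℕ (F (2 + j) + y)    ∎
  where
  open ≡-Reasoning
  y<F₁ : y < F (1 + j)
  y<F₁ = +-cancelˡ-< (F (2 + j)) y (F (1 + j)) x<F₃
  y+2≤F₃ : y + 2 ≤ F (3 + j)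
  y+2≤F₃ = subst₂ _≤_ (sym (+-suc y 1)) (+-comm (F (1 + j)) (F (2 + j))) (+-mono-≤ y<F₁ (F-pos (2 + j)))

θℕ-F+′ : ∀ j x → x < F (3 + j) → suc x ≢ F (2 + j) → θℕ (F (1 + j) + x) ≡ F (2 + j) + θℕ x
θℕ-F+′ j x x<F₃ 1+x≢F₂ with x + 2 ≤? F (2 + j)
... | yes x+2≤F₂ = θℕ-F+ j x x+2≤F₂
... | no  x+2≰F₂ = θℕ-F+-large j x F₂≤x x<F₃
  where
  F₂≤1+x : F (2 + j) ≤ suc x
  F₂≤1+x = ≤-pred (subst (F (2 + j) <_) (+-comm x 2) (≰⇒> x+2≰F₂))
  F₂≤x : F (2 + j) ≤ x
  F₂≤x = ≤-pred (≤∧≢⇒< F₂≤1+x (1+x≢F₂ ∘ sym))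

-- ι and α on lengths

==⇒≡ : ∀ u v → (u == v) ≡ true → u ≡ v
==⇒≡ []      []      _  = refl
==⇒≡ (a ∷ u) (a ∷ v) eq = cong (a ∷_) (==⇒≡ u v eq)
==⇒≡ (b ∷ u) (b ∷ v) eq = cong (b ∷_) (==⇒≡ u v eq)
==⇒≡ []      (_ ∷ _) ()
==⇒≡ (_ ∷ _) []      ()
==⇒≡ (a ∷ u) (b ∷ v) ()
==⇒≡ (b ∷ u) (a ∷ v) ()

==-refl : ∀ u → (u == u) ≡ true
==-refl []      = refl
==-refl (a ∷ u) = ==-refl u
==-refl (b ∷ u) = ==-refl u

inFUpTo⇒≡wF : ∀ k v → inFUpTo k v ≡ true → ∃ λ j → v ≡ wF j
inFUpTo⇒≡wF zero    v eq = zero , ==⇒≡ v [] eq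
inFUpTo⇒≡wF (suc k) v eq with v == wF (suc k) in v≟wₖ
... | true  = suc k , ==⇒≡ v (wF (suc k)) v≟wₖ
... | false = inFUpTo⇒≡wF k v eq

inFUpTo-wF : ∀ {j k} → j ≤ k → inFUpTo k (wF j) ≡ true
inFUpTo-wF {zero} {zero}  z≤n = refl
inFUpTo-wF {j}    {suc k} j≤1+k with m≤n⇒m<n∨m≡n j≤1+k
... | inj₂ refl      = cong (_∨ inFUpTo k (wF j)) (==-refl (wF j))
... | inj₁ (s≤s j≤k) = trans (cong (wF j == wF (suc k) ∨_) (inFUpTo-wF j≤k)) (∨-zeroʳ _)

inF-pref⇒ : ∀ n → inF (pref n) ≡ true → n ≡ 0 ⊎ ∃ λ j → n ≡ F (suc j)
inF-pref⇒ n eq with inFUpTo⇒≡wF (suc (length (pref n))) (pref n) eq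
... | zero  , pref-n≡w₀ = inj₁ (trans (sym (length-pref n)) (cong length pref-n≡w₀))
... | suc j , pref-n≡wⱼ =
  inj₂ (j , trans (sym (length-pref n)) (trans (cong length pref-n≡wⱼ) (length-wF j)))

inF-pref-F : ∀ j → inF (pref (F (suc j))) ≡ true
inF-pref-F j rewrite pref-F j =
  inFUpTo-wF (s≤s (subst (j ≤_) (sym (length-wF j)) (≤-trans (n≤1+n j) (n≤F (suc j)))))

ιℕ : ℕ → ℕ
ιℕ n = if inF (pref n) then n else n ∸ 2 * F (idxUpTo n n ∸ 2)

ι-pref : ∀ n → ι (pref n) ≡ pref (ιℕ n)
ι-pref n with inF (pref n)
... | true  = refl
... | false = cong (λ t → pref (t ∸ 2 * F (idxUpTo t t ∸ 2))) (length-pref n)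

ιℕ-fixed : ∀ {n} → inF (pref n) ≡ true → ιℕ n ≡ n
ιℕ-fixed eq rewrite eq = refl

ιℕ-≤ : ∀ n → ιℕ n ≤ n
ιℕ-≤ n with inF (pref n)
... | true  = ≤-refl
... | false = m∸n≤m n (2 * F (idxUpTo n n ∸ 2))

ιℕ-< : ∀ {n} → inF (pref n) ≡ false → ιℕ n < n
ιℕ-< {zero}        ()
ιℕ-< {n@(suc _)} eq rewrite eq = m<n+o⇒m∸n<o n (2 * F i) (m<n+m n 0<2Fᵢ)
  where
  i : ℕ
  i = idxUpTo n n ∸ 2
  0<2Fᵢ : 0 < 2 * F i
  0<2Fᵢ = ≤-trans (F-pos i) (m≤m+n (F i) _)

infix 4 _⇓_

data _⇓_ : ℕ → ℕ → Set where
  fixed : ∀ {n}   → inF (pref n) ≡ true → n ⇓ n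
  step  : ∀ {n r} → inF (pref n) ≡ false → ιℕ n ⇓ r → n ⇓ r

⇓-≤ : ∀ {n r} → n ⇓ r → r ≤ n
⇓-≤     (fixed _)     = ≤-refl
⇓-≤ {n} (step _ ιn⇓r) = ≤-trans (⇓-≤ ιn⇓r) (ιℕ-≤ n)

⇓-total : ∀ n → ∃ (n ⇓_)
⇓-total = <-rec (λ n → ∃ (n ⇓_)) go
  where
  go : ∀ n → (∀ {m} → m < n → ∃ (m ⇓_)) → ∃ (n ⇓_)
  go n rec with inF (pref n) in eq
  ... | true  = n , fixed eq
  ... | false = let r , ιn⇓r = rec (ιℕ-< eq) in r , step eq ιn⇓r

iter-suc : ∀ k v → iter (suc k) v ≡ iter k (ι v)
iter-suc zero    v = refl
iter-suc (suc k) v = cong ι (iter-suc k v)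

iter-fixed : ∀ {v} → ι v ≡ v → ∀ k → iter k v ≡ v
iter-fixed ιv≡v zero    = refl
iter-fixed ιv≡v (suc k) = trans (cong ι (iter-fixed ιv≡v k)) ιv≡v

⇓⇒IsAlpha : ∀ {n r} → n ⇓ r → IsAlpha (pref n) (pref r)
⇓⇒IsAlpha {n} (fixed eq) = 0 , λ k _ → iter-fixed (trans (ι-pref n) (cong pref (ιℕ-fixed eq))) k
⇓⇒IsAlpha {n} (step _ ιn⇓r) with ⇓⇒IsAlpha ιn⇓r
... | K , stable = suc K , λ where
  (suc k) (s≤s K≤k) → trans (iter-suc k (pref n)) (trans (cong (iter k) (ι-pref n)) (stable k K≤k))

IsAlpha-unique : ∀ {v u₁ u₂} → IsAlpha v u₁ → IsAlpha v u₂ → u₁ ≡ u₂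
IsAlpha-unique (K₁ , stable₁) (K₂ , stable₂) =
  trans (sym (stable₁ (K₁ ⊔ K₂) (m≤m⊔n K₁ K₂))) (stable₂ (K₁ ⊔ K₂) (m≤n⊔m K₁ K₂))

idxUpTo-≡ : ∀ {k i x} → i ≤ k → F i < x → x ≤ F (suc i) → idxUpTo k x ≡ i
idxUpTo-≡ {zero}  z≤n _ _ = refl
idxUpTo-≡ {suc k} {i} {x} i≤1+k Fᵢ<x x≤Fᵢ₊₁ with F (suc k) <ᵇ x in eq | m≤n⇒m<n∨m≡n i≤1+k
... | true  | inj₂ refl      = refl
... | true  | inj₁ (s≤s i≤k) =
  contradiction (≤-trans x≤Fᵢ₊₁ (F-mono (s≤s i≤k))) (<⇒≱ (<ᵇ⇒< (F (suc k)) x (subst T (sym eq) _)))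
... | false | inj₂ refl      = contradiction (subst T eq (<⇒<ᵇ Fᵢ<x)) λ ()
... | false | inj₁ (s≤s i≤k) = idxUpTo-≡ i≤k Fᵢ<x x≤Fᵢ₊₁

ιℕ-between : ∀ {i n} → F i < n → n < F (suc i) → inF (pref n) ≡ false × ιℕ n ≡ n ∸ 2 * F (i ∸ 2)
ιℕ-between {i} {n} Fᵢ<n n<Fᵢ₊₁ with inF (pref n) in eq
... | false =
  refl , cong (λ t → n ∸ 2 * F (t ∸ 2)) (idxUpTo-≡ (≤-trans (n≤F i) (<⇒≤ Fᵢ<n)) Fᵢ<n (<⇒≤ n<Fᵢ₊₁))
... | true with inF-pref⇒ n eq
...   | inj₁ refl       = contradiction Fᵢ<n n≮0
...   | inj₂ (j , n≡Fⱼ) = contradiction n≡Fⱼ (F-gap i (suc j) Fᵢ<n n<Fᵢ₊₁)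

F-bracket : ∀ k {n} → 1 < n → n ≤ F k → ∃ λ i → F i < n × n ≤ F (suc i)
F-bracket zero    1<n n≤1    = contradiction n≤1 (<⇒≱ 1<n)
F-bracket (suc k) {n} 1<n n≤Fₖ₊₁ with n ≤? F k
... | yes n≤Fₖ = F-bracket k 1<n n≤Fₖ
... | no  n≰Fₖ = k , ≰⇒> n≰Fₖ , n≤Fₖ₊₁

F-interval : ∀ {n} → inF (pref n) ≡ false → ∃ λ i → F i < n × n < F (suc i)
F-interval {zero}            ()
F-interval {suc zero}        ()
F-interval {n@(suc (suc _))} not-in-F with F-bracket n (s≤s (s≤s z≤n)) (n≤F n)
... | i , Fᵢ<n , n≤Fᵢ₊₁ = i , Fᵢ<n , ≤∧≢⇒< n≤Fᵢ₊₁ n≢Fᵢ₊₁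
  where
  n≢Fᵢ₊₁ : n ≢ F (suc i)
  n≢Fᵢ₊₁ n≡Fᵢ₊₁ =
    contradiction (trans (sym (inF-pref-F i)) (subst (λ t → inF (pref t) ≡ false) n≡Fᵢ₊₁ not-in-F)) λ ()

split-interval : ∀ {s d n} → s < n → n < s + d → ∃ λ m → (0 < m × m < d) × n ≡ s + m
split-interval {s} {d} {n} s<n n<s+d =
  n ∸ s , (m<n⇒0<n∸m s<n , +-cancelˡ-< s (n ∸ s) d (subst (_< s + d) (sym s+[n∸s]≡n) n<s+d)) ,
  sym s+[n∸s]≡n
  where
  s+[n∸s]≡n : s + (n ∸ s) ≡ n
  s+[n∸s]≡n = m+[n∸m]≡n (<⇒≤ s<n)

-- The lengths F (4 + j) + m with Offset j m are those of the paper's w_{j+4} < v < w_{j+5}.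
record Offset (j m : ℕ) : Set where
  constructor offset
  field
    0<m  : 0 < m
    m<F₃ : m < F (3 + j)

F-interval-offset : ∀ k {n} → F (4 + k) ≤ n → inF (pref n) ≡ false →
                    ∃₂ λ j m → Offset (k + j) m × n ≡ F (4 + (k + j)) + m
F-interval-offset k {n} F≤n not-in-F with F-interval not-in-F
... | i , Fᵢ<n , n<Fᵢ₊₁ with 4 + k ≤? i
...   | no  i≱4+k =
  contradiction (≤-<-trans F≤n (<-≤-trans n<Fᵢ₊₁ (F-mono (≰⇒> i≱4+k)))) (<-irrefl refl)
...   | yes 4+k≤i with m≤n⇒∃[o]m+o≡n 4+k≤i
...     | j , refl =
  let m , (0<m , m<F₃) , n≡F₄+m = split-interval Fᵢ<n n<Fᵢ₊₁ in j , m , offset 0<m m<F₃ , n≡F₄+m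

ιℕ-F₄+ : ∀ {j m} → Offset j m →
         inF (pref (F (4 + j) + m)) ≡ false × ιℕ (F (4 + j) + m) ≡ F (1 + j) + m
ιℕ-F₄+ {j} {m} (offset 0<m m<F₃)
  with ιℕ-between {4 + j} (m<m+n (F (4 + j)) 0<m) (+-monoʳ-< (F (4 + j)) m<F₃)
... | not-in-F , ιn≡ = not-in-F , (begin
  ιℕ (F (4 + j) + m)                             ≡⟨ ιn≡ ⟩
  F (4 + j) + m ∸ 2 * F (2 + j)                  ≡⟨ cong (_∸ 2 * F (2 + j)) (F₄+m≡F₁+m+2F₂ j m) ⟩
  F (1 + j) + m + 2 * F (2 + j) ∸ 2 * F (2 + j)  ≡⟨ m+n∸n≡m (F (1 + j) + m) (2 * F (2 + j)) ⟩
  F (1 + j) + m                                  ∎)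
  where open ≡-Reasoning

⇓-F₄+ : ∀ {j m r} → Offset j m → F (1 + j) + m ⇓ r → F (4 + j) + m ⇓ r
⇓-F₄+ {r = r} o F₁+m⇓r =
  let not-in-F , ιn≡ = ιℕ-F₄+ o in step not-in-F (subst (_⇓ r) (sym ιn≡) F₁+m⇓r)

⇓-F₄+⁻¹ : ∀ {j m r} → Offset j m → F (4 + j) + m ⇓ r → F (1 + j) + m ⇓ r
⇓-F₄+⁻¹         o (fixed in-F)  = contradiction (trans (sym in-F) (proj₁ (ιℕ-F₄+ o))) λ ()
⇓-F₄+⁻¹ {r = r} o (step _ ιn⇓r) = subst (_⇓ r) (proj₂ (ιℕ-F₄+ o)) ιn⇓r

-- θ commutes with ι

F∸1⇓≤3 : ∀ k {r} → F k ∸ 1 ⇓ r → r ≤ 3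
F∸1⇓≤3 0 (fixed _)          = z≤n
F∸1⇓≤3 1 (fixed _)          = z≤n
F∸1⇓≤3 2 (fixed _)          = s≤s z≤n
F∸1⇓≤3 3 (fixed _)          = s≤s (s≤s z≤n)
F∸1⇓≤3 4 (step _ (fixed _)) = s≤s (s≤s z≤n)
F∸1⇓≤3 5 (step _ (fixed _)) = s≤s (s≤s (s≤s z≤n))
F∸1⇓≤3 (suc (suc (suc (suc (suc (suc j)))))) {r} F₆∸1⇓r = F∸1⇓≤3 (suc (suc (suc j))) F₃∸1⇓r
  where
  open ≡-Reasoning
  offset₀ : Offset j (F (2 + j) ∸ 1)
  offset₀ = offset (∸-monoˡ-< (2≤F j) (s≤s z≤n))
                   (<-≤-trans (∸-monoʳ-< z<s (F-pos (2 + j))) (F≤F-suc (2 + j)))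
  offset₁ : Offset (1 + j) (F (4 + j) ∸ 1)
  offset₁ = offset (∸-monoˡ-< (≤-trans (2≤F j) (F-mono (m≤n+m (2 + j) 2))) (s≤s z≤n))
                   (∸-monoʳ-< z<s (F-pos (4 + j)))
  F₂+[F₄∸1]≡F₄+[F₂∸1] : F (2 + j) + (F (4 + j) ∸ 1) ≡ F (4 + j) + (F (2 + j) ∸ 1)
  F₂+[F₄∸1]≡F₄+[F₂∸1] = begin
    F (2 + j) + (F (4 + j) ∸ 1)  ≡⟨ +-∸-assoc (F (2 + j)) (F-pos (4 + j)) ⟨
    F (2 + j) + F (4 + j) ∸ 1    ≡⟨ cong (_∸ 1) (+-comm (F (2 + j)) (F (4 + j))) ⟩
    F (4 + j) + F (2 + j) ∸ 1    ≡⟨ +-∸-assoc (F (4 + j)) (F-pos (2 + j)) ⟩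
    F (4 + j) + (F (2 + j) ∸ 1)  ∎
  F₁+[F₂∸1]≡F₃∸1 : F (1 + j) + (F (2 + j) ∸ 1) ≡ F (3 + j) ∸ 1
  F₁+[F₂∸1]≡F₃∸1 = begin
    F (1 + j) + (F (2 + j) ∸ 1)  ≡⟨ +-∸-assoc (F (1 + j)) (F-pos (2 + j)) ⟨
    F (1 + j) + F (2 + j) ∸ 1    ≡⟨ cong (_∸ 1) (+-comm (F (1 + j)) (F (2 + j))) ⟩
    F (3 + j) ∸ 1                ∎
  F₂+[F₄∸1]⇓r : F (2 + j) + (F (4 + j) ∸ 1) ⇓ r
  F₂+[F₄∸1]⇓r = ⇓-F₄+⁻¹ offset₁ (subst (_⇓ r) (+-∸-assoc (F (5 + j)) (F-pos (4 + j))) F₆∸1⇓r)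
  F₃∸1⇓r : F (3 + j) ∸ 1 ⇓ r
  F₃∸1⇓r = subst (_⇓ r) F₁+[F₂∸1]≡F₃∸1
             (⇓-F₄+⁻¹ offset₀ (subst (_⇓ r) F₂+[F₄∸1]≡F₄+[F₂∸1] F₂+[F₄∸1]⇓r))

-- The exceptional case of θℕ-F+′ has α ≤ w_3; this is where ℓ ≥ 4 is needed.
⇓>3⇒1+m≢F₂ : ∀ j {m r} → 3 < r → F (1 + j) + m ⇓ r → suc m ≢ F (2 + j)
⇓>3⇒1+m≢F₂ j {m} {r} 3<r F₁+m⇓r 1+m≡F₂ =
  <⇒≱ 3<r (F∸1⇓≤3 (3 + j) (subst (_⇓ r) F₁+m≡F₃∸1 F₁+m⇓r))
  where
  open ≡-Reasoning
  F₁+m≡F₃∸1 : F (1 + j) + m ≡ F (3 + j) ∸ 1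
  F₁+m≡F₃∸1 = begin
    F (1 + j) + m              ≡⟨ +-comm (F (1 + j)) m ⟩
    suc m + F (1 + j) ∸ 1      ≡⟨ cong (λ t → t + F (1 + j) ∸ 1) 1+m≡F₂ ⟩
    F (2 + j) + F (1 + j) ∸ 1  ∎

θℕ-F₄+ : ∀ {j m} → Offset j m → θℕ (F (4 + j) + m) ≡ F (5 + j) + θℕ m
θℕ-F₄+ {j} {m} (offset _ m<F₃) = θℕ-F+ (3 + j) m m+2≤F₅
  where
  m+2≤F₅ : m + 2 ≤ F (5 + j)
  m+2≤F₅ = subst₂ _≤_ (sym (+-suc m 1)) (+-comm (F (3 + j)) (F (4 + j))) (+-mono-≤ m<F₃ (F-pos (4 + j)))

θℕ-Offset : ∀ {j m} → Offset j m → Offset (suc j) (θℕ m)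
θℕ-Offset {j} {m} (offset 0<m m<F₃) =
  offset (θℕ-mono-< 0<m) (subst (θℕ m <_) (θℕ-F (2 + j)) (θℕ-mono-< m<F₃))

θℕ-Offset⁻¹ : ∀ {j n μ} → θℕ n ≡ F (2 + j) + μ → Offset (suc j) μ →
              ∃ λ m → Offset j m × n ≡ F (1 + j) + m
θℕ-Offset⁻¹ {j} {n} θn≡F₂+μ (offset 0<μ μ<F₄) =
  let m , (0<m , m<F₃) , n≡F₁+m = split-interval F₁<n n<F₁+F₃ in m , offset 0<m m<F₃ , n≡F₁+m
  where
  F₁<n : F (1 + j) < n
  F₁<n = θℕ-cancel-< (subst₂ _<_ (sym (θℕ-F j)) (sym θn≡F₂+μ) (m<m+n (F (2 + j)) 0<μ))
  θ[F₃+F₁]≡F₂+F₄ : θℕ (F (3 + j) + F (1 + j)) ≡ F (2 + j) + F (4 + j)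
  θ[F₃+F₁]≡F₂+F₄ = trans (θℕ-F+ (2 + j) (F (1 + j)) (+-mono-≤ (F-mono (m≤n+m (1 + j) 2)) (2≤F j)))
                          (trans (cong (F (4 + j) +_) (θℕ-F j)) (+-comm (F (4 + j)) (F (2 + j))))
  n<F₁+F₃ : n < F (1 + j) + F (3 + j)
  n<F₁+F₃ = subst (n <_) (+-comm (F (3 + j)) (F (1 + j))) (θℕ-cancel-<
              (subst₂ _<_ (sym θn≡F₂+μ) (sym θ[F₃+F₁]≡F₂+F₄) (+-monoʳ-< (F (2 + j)) μ<F₄)))

θℕ-⇓ : ∀ {n r} → F 4 ≤ r → n ⇓ r → θℕ n ⇓ θℕ r
θℕ-⇓ {n} F₄≤r (fixed in-F) with inF-pref⇒ n in-F
... | inj₁ refl       = contradiction F₄≤r λ ()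
... | inj₂ (j , refl) = subst (λ t → t ⇓ t) (sym (θℕ-F j)) (fixed (inF-pref-F (suc j)))
θℕ-⇓ {n} {r} F₄≤r (step not-in-F ιn⇓r)
  with F-interval-offset 0 {n} (≤-trans F₄≤r (⇓-≤ (step not-in-F ιn⇓r))) not-in-F
... | j , m , o , refl = subst (_⇓ θℕ r) (sym (θℕ-F₄+ o)) (⇓-F₄+ (θℕ-Offset o) F₂+θm⇓θr)
  where
  ιn≡F₁+m : ιℕ (F (4 + j) + m) ≡ F (1 + j) + m
  ιn≡F₁+m = proj₂ (ιℕ-F₄+ o)
  1+m≢F₂ : suc m ≢ F (2 + j)
  1+m≢F₂ = ⇓>3⇒1+m≢F₂ j (≤-trans (n≤1+n 4) F₄≤r) (subst (_⇓ r) ιn≡F₁+m ιn⇓r)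
  F₂+θm⇓θr : F (2 + j) + θℕ m ⇓ θℕ r
  F₂+θm⇓θr = subst (_⇓ θℕ r) (trans (cong θℕ ιn≡F₁+m) (θℕ-F+′ j m (Offset.m<F₃ o) 1+m≢F₂))
                   (θℕ-⇓ F₄≤r ιn⇓r)

θℕ-⇓-surjective : ∀ {M r} → F 5 ≤ r → M ⇓ r →
                  ∃₂ λ n r′ → θℕ n ≡ M × n ⇓ r′ × θℕ r′ ≡ r
θℕ-⇓-surjective {M} F₅≤r (fixed in-F) with inF-pref⇒ M in-F
... | inj₁ refl           = contradiction F₅≤r λ ()
... | inj₂ (zero , refl)  = contradiction F₅≤r λ { (s≤s ()) }
... | inj₂ (suc j , refl) = F (suc j) , F (suc j) , θℕ-F j , fixed (inF-pref-F j) , θℕ-F j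
θℕ-⇓-surjective {M} F₅≤r (step not-in-F ιM⇓r)
  with F-interval-offset 1 {M} (≤-trans F₅≤r (⇓-≤ (step not-in-F ιM⇓r))) not-in-F
... | j , μ , o , refl with θℕ-⇓-surjective F₅≤r ιM⇓r
...   | n₁ , r′ , θn₁≡ιM , n₁⇓r′ , θr′≡r
  with θℕ-Offset⁻¹ {n = n₁} (trans θn₁≡ιM (proj₂ (ιℕ-F₄+ o))) o
...     | m , o′ , refl = F (4 + j) + m , r′ , θ[F₄+m]≡M , ⇓-F₄+ o′ n₁⇓r′ , θr′≡r
  where
  F₄≤r′ : F 4 ≤ r′
  F₄≤r′ = θℕ-cancel-≤ (subst₂ _≤_ (sym (θℕ-F 3)) (sym θr′≡r) F₅≤r)
  1+m≢F₂ : suc m ≢ F (2 + j)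
  1+m≢F₂ = ⇓>3⇒1+m≢F₂ j (≤-trans (n≤1+n 4) F₄≤r′) n₁⇓r′
  θm≡μ : θℕ m ≡ μ
  θm≡μ = +-cancelˡ-≡ (F (2 + j)) (θℕ m) μ
           (trans (sym (θℕ-F+′ j m (Offset.m<F₃ o′) 1+m≢F₂)) (trans θn₁≡ιM (proj₂ (ιℕ-F₄+ o))))
  θ[F₄+m]≡M : θℕ (F (4 + j) + m) ≡ F (5 + j) + μ
  θ[F₄+m]≡M = trans (θℕ-F₄+ o′) (cong (F (5 + j) +_) θm≡μ)

V⇒⇓ : ∀ l {v} → V (suc l) v → ∃₂ λ n r → v ≡ pref n × n ⇓ r × F (suc l) ≤ r
V⇒⇓ l {v} (v-prefix , u , αv≡u , wₗ⊑u) with ⇓-total (length v)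
... | r , |v|⇓r = length v , r , v≡pref , |v|⇓r , F≤r
  where
  v≡pref : v ≡ pref (length v)
  v≡pref = PrefixW∞⇒≡pref v-prefix
  u≡pref-r : u ≡ pref r
  u≡pref-r = IsAlpha-unique (subst (λ t → IsAlpha t u) v≡pref αv≡u) (⇓⇒IsAlpha |v|⇓r)
  F≤r : F (suc l) ≤ r
  F≤r = subst₂ _≤_ (length-wF l) (trans (cong length u≡pref-r) (length-pref r)) (length-mono-⊑ wₗ⊑u)

⇓⇒V : ∀ l {n r} → n ⇓ r → F (suc l) ≤ r → V (suc l) (pref n)
⇓⇒V l {n} {r} n⇓r F≤r =
  PrefixW∞-pref n , pref r , ⇓⇒IsAlpha n⇓r ,
  PrefixW∞-⊑ (suc l , ⊑-refl) (PrefixW∞-pref r) (subst₂ _≤_ (sym (length-wF l)) (sym (length-pref r)) F≤r)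

proposition5p7 : (ℓ : ℕ) → 4 ≤ ℓ →
    ((v : Word) → V ℓ v → V (ℓ + 1) (θ v))
    × ((u v : Word) → V ℓ u → V ℓ v → θ u ≡ θ v → u ≡ v)
    × ((x : Word) → V (ℓ + 1) x → ∃ λ v → V ℓ v × θ v ≡ x)
    × ((u v : Word) → V ℓ u → V ℓ v → u ⊑ v → θ u ⊑ θ v)
proposition5p7 ℓ@(suc l) 4≤ℓ rewrite +-comm ℓ 1 =
  θ-into , (λ _ _ _ _ → θ-injective) , θ-onto , (λ _ _ _ _ → θ-mono-⊑)
  where
  θ-into : (v : Word) → V ℓ v → V (suc ℓ) (θ v)
  θ-into v Vv with V⇒⇓ l Vv
  ... | n , r , refl , n⇓r , F≤r =
    subst (V (suc ℓ)) (sym (θ-pref n))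
          (⇓⇒V ℓ (θℕ-⇓ (≤-trans (F-mono 4≤ℓ) F≤r) n⇓r)
                 (subst (_≤ θℕ r) (θℕ-F l) (θℕ-mono-≤ F≤r)))
  θ-onto : (x : Word) → V (suc ℓ) x → ∃ λ v → V ℓ v × θ v ≡ x
  θ-onto x Vx with V⇒⇓ ℓ Vx
  ... | M , r , refl , M⇓r , F≤r with θℕ-⇓-surjective (≤-trans (F-mono (s≤s 4≤ℓ)) F≤r) M⇓r
  ...   | n , r′ , refl , n⇓r′ , refl =
    pref n , ⇓⇒V l n⇓r′ (θℕ-cancel-≤ (subst (_≤ θℕ r′) (sym (θℕ-F l)) F≤r)) , θ-pref n
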